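{- Consider a black-white array (as defined in the context) holding $n$ values, where $n$ is $k$-trailed, and insert a new value. Then: (a) the result of the $k$ recursive merges is held in the white segment of rank $k$, and it contains all the values that were in the segments of rank smaller than $k$ (together with the new value); (b) all segments of rank smaller than $k$ are inactive once the insertion is completed; (c) if $n$ is strongly $k$-trailed, then after the insertion all the values in the black-white array are held in the segment of rank $k$.
   Context: Black-white array (BWA) of size $N=2^K$: values from a totally ordered set are stored in a white array $W$ with indices $1,\dots,N-1$ and a black array $B$ with indices $1,\dots,N/2-1$. For a rank $j$, the segment of rank $j$ of an array consists of the indices in $[2^j,2^{j+1}-1]$ (it has $2^j$ entries). A state variable $\mathtt{total}$ records the number of values stored. The segment of rank $i$ is called active iff the $i$-th least significant bit (counting from $0$) of the binary form of $\mathtt{total}$ equals $1$; in a stable state all stored values lie in the active white segments, each sorted in ascending order; contents of inactive segments are ignored. Insert$(v)$: if the rank-$0$ segment is inactive, set $W[1]=v$; otherwise set $B[1]=v$ and call $\mathrm{merge}(0)$. Here $\mathrm{merge}(i)$ merges the sorted black and white segments of rank $i$ by a standard two-way merge; if the segment of rank $i+1$ is inactive the sorted result is written into the white segment of rank $i+1$, and otherwise it is written into the black segment of rank $i+1$ and then $\mathrm{merge}(i+1)$ is called. Activity tests during an insertion refer to $\mathtt{total}$ before the insertion; when the insertion completes, $\mathtt{total}$ is increased by one. A nonnegative integer $n$ is $k$-trailed if its $k$ least significant binary digits are $1$ and its bit number $k$ is $0$; it is strongly $k$-trailed if moreover all its bits of position greater than $k$ are $0$ (i.e. $n=2^k-1$).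 -}

module Defs where

open import Level using (Level)
open import Data.Bool using (Bool; true; false; if_then_else_)
open import Data.Nat using (ℕ; zero; suc; _+_; _^_; _≡ᵇ_; _<_; _%_; _/_)
open import Data.List using (List; []; _∷_; map; upTo; concat; merge; filter)
open import Relation.Binary.Bundles using (DecTotalOrder)
open import Relation.Binary.PropositionalEquality using (_≡_)
open import Relation.Nullary using (does)
open import Data.Product using (_×_; _,_; proj₁; proj₂)

bit : ℕ → ℕ → ℕ
bit n zero    = n % 2
bit n (suc i) = bit (n / 2) i

-- segment of rank i is active for a given value of total
Active : ℕ → ℕ → Set
Active total i = bit total i ≡ 1

active? : ℕ → ℕ → Bool
active? total i = bit total i ≡ᵇ 1

KTrailed : ℕ → ℕ → Set
KTrailed k n = (∀ i → i < k → bit n i ≡ 1) × (bit n k ≡ 0)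
  where open import Data.Product using (_×_)

StronglyKTrailed : ℕ → ℕ → Set
StronglyKTrailed k n = KTrailed k n × (∀ i → k < i → bit n i ≡ 0)
  where open import Data.Product using (_×_)

module BWA {a ℓ₁ ℓ₂ : Level} (O : DecTotalOrder a ℓ₁ ℓ₂) where
  open DecTotalOrder O renaming (Carrier to A) using (_≤?_)
  open import Data.List.Relation.Unary.Sorted.TotalOrder
    (DecTotalOrder.totalOrder O) using (Sorted)

  -- arrays are modelled as functions from indices to values; only the
  -- indices 1..N-1 (white) and 1..N/2-1 (black) are ever read/written
  -- by the operations below.
  record State : Set a where
    constructor mkState
    field
      W     : ℕ → A
      B     : ℕ → A
      total : ℕ
  open State public

  seg : (ℕ → A) → ℕ → List A
  seg f j = map (λ i → f (2 ^ j + i)) (upTo (2 ^ j))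

  update : (ℕ → A) → ℕ → A → (ℕ → A)
  update f p x idx = if idx ≡ᵇ p then x else f idx

  writeFrom : (ℕ → A) → ℕ → List A → (ℕ → A)
  writeFrom f base []       = f
  writeFrom f base (x ∷ xs) = update (writeFrom f (suc base) xs) base x

  writeSeg : (ℕ → A) → ℕ → List A → (ℕ → A)
  writeSeg f j l = writeFrom f (2 ^ j) l

  -- merge(i), with the value t of total before the insertion; recursion
  -- depth is bounded by a fuel argument (K suffices for an array of size 2^K)
  mergeRec : ℕ → ℕ → ℕ → (ℕ → A) → (ℕ → A) → (ℕ → A) × (ℕ → A)
  mergeRec zero       t i w b = w , b
  mergeRec (suc fuel) t i w b =
    let m = merge _≤?_ (seg b i) (seg w i) in
    if active? t (suc i)
      then mergeRec fuel t (suc i) w (writeSeg b (suc i) m)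
      else (writeSeg w (suc i) m , b)

  insert : (K : ℕ) → A → State → State
  insert K v (mkState w b t) =
    if active? t 0
      then (let r = mergeRec K t 0 w (update b 1 v)
            in mkState (proj₁ r) (proj₂ r) (suc t))
      else mkState (update w 1 v) b (suc t)

  Stable : State → Set (a Level.⊔ ℓ₂)
  Stable s = ∀ i → Active (total s) i → Sorted (seg (W s) i)

  contents : ℕ → State → List A
  contents K s =
    concat (map (seg (W s)) (filter (λ i → bit (total s) i Data.Nat.≟ 1) (upTo K)))
    where import Data.Nat

module Submission where

-- Adding one to a k-trailed t clears bits 0..k-1, sets bit k and
-- leaves the higher bits alone (`increment-trailed`); moreover 2^k ≤ t + 1
-- (`trailed-bound`), so if t + 1 < 2^K the fuel K of the merge cascade
-- exceeds k.
--
-- Invariant of the cascade: when merge(i) is called, the black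
-- segment of rank i holds a permutation of v together with the white
-- segments of ranks < i.  Merging adds the white segment of rank i, and the
-- result is carried on (bit i+1 set) or stored in the white segment of
-- rank i+1 (bit i+1 clear); at rank k the cascade stops (`cascade`).
--
-- The theorem: part (a) is `insert-collects`, part (b) follows from
-- `increment-trailed` since the new total is t + 1 (`total-insert`), and
-- part (c) holds because t + 1 = 2^k has only bit k set, so the only
-- active segment is the white one of rank k (`contents-single`).

open import Defs
open import Level using (Level)
open import Data.Nat using (ℕ; zero; suc; _+_; _*_; _<_; _≤_; _^_; _≡ᵇ_; _%_; _/_; z≤n; s≤s; z<s; s<s)
open import Data.Nat.Properties
  using (+-identityʳ; +-suc; <-≤-trans; *-suc; *-monoʳ-≤; ^-monoʳ-≤; ≤-trans; ≤-refl; n≤1+n; <⇒≤; <⇒≱; ≰⇒>;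
         <-irrefl; m≤n⇒m<n∨m≡n; <-cmp; 0≢1+n; _≟_)
open import Data.Nat.DivMod using (m/n≡1+[m∸n]/n)
open import Data.Bool using (true; false)
open import Data.List using (List; []; _∷_; _++_; concat; map; upTo; applyUpTo; length; merge; filter)
open import Data.List.Properties
  using (map-upTo; map-cong; length-map; length-upTo; length-++; upTo-∷ʳ; map-++; concat-++; ++-identityʳ;
         filter-++; filter-accept; filter-reject)
open import Data.List.Relation.Binary.Permutation.Propositional using (_↭_; ↭-refl; ↭-trans; ↭-reflexive)
open import Data.List.Relation.Binary.Permutation.Propositional.Properties
  using (merge-↭; ↭-length; ++⁺ʳ)
open import Data.Product using (_×_; _,_; proj₁; proj₂)
open import Data.Sum using (inj₁; inj₂)
open import Data.Empty using (⊥-elim)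
open import Relation.Nullary using (¬_; Dec)
open import Relation.Binary.Bundles using (DecTotalOrder)
open import Relation.Binary.PropositionalEquality using (_≡_; refl; sym; trans; cong; cong₂; subst; module ≡-Reasoning)
open import Relation.Binary.Definitions using (tri<; tri≈; tri>)

data Parity (n : ℕ) : Set where
  even : n % 2 ≡ 0 → suc n % 2 ≡ 1 → suc n / 2 ≡ n / 2 → Parity n
  odd  : n % 2 ≡ 1 → suc n % 2 ≡ 0 → suc n / 2 ≡ suc (n / 2) → suc n ≡ 2 * suc (n / 2) → Parity n

halve-+2 : ∀ n → suc (suc n) / 2 ≡ suc (n / 2)
halve-+2 n = m/n≡1+[m∸n]/n {suc (suc n)} {2} (s≤s (s≤s z≤n))

parity : ∀ n → Parity n
parity zero          = even refl refl refl
parity (suc zero)    = odd refl refl refl refl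
parity (suc (suc n)) with parity n
... | even n%2 sn%2 sn/2 = even n%2 sn%2 (trans (halve-+2 (suc n)) (trans (cong suc sn/2) (sym (halve-+2 n))))
... | odd n%2 sn%2 sn/2 sn =
  odd n%2 sn%2 (trans (halve-+2 (suc n)) (trans (cong suc sn/2) (cong suc (sym (halve-+2 n)))))
      (trans (cong (λ m → suc (suc m)) sn)
        (trans (sym (*-suc 2 (suc (n / 2)))) (cong (λ q → 2 * suc q) (sym (halve-+2 n)))))

increment-trailed : ∀ k t → (∀ i → i < k → bit t i ≡ 1) → bit t k ≡ 0 →
  (∀ i → i < k → bit (suc t) i ≡ 0) × bit (suc t) k ≡ 1 × (∀ i → k < i → bit (suc t) i ≡ bit t i)
increment-trailed zero t low bitk with parity t
... | even _ sn%2 sn/2 = (λ _ ()) , sn%2 , λ { (suc j) _ → cong (λ m → bit m j) sn/2 }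
... | odd t%2 _ _ _   = ⊥-elim (0≢1+n (trans (sym bitk) t%2))
increment-trailed (suc k) t low bitk with parity t
... | even t%2 _ _ = ⊥-elim (0≢1+n (trans (sym t%2) (low 0 z<s)))
... | odd _ sn%2 sn/2 _ with increment-trailed k (t / 2) (λ i i<k → low (suc i) (s<s i<k)) bitk
...   | cleared , set , kept =
  (λ { zero _ → sn%2 ; (suc j) (s<s j<k) → trans (cong (λ m → bit m j) sn/2) (cleared j j<k) })
  , trans (cong (λ m → bit m k) sn/2) set
  , λ { (suc j) (s<s k<j) → trans (cong (λ m → bit m j) sn/2) (kept j k<j) }

trailed-bound : ∀ k t → (∀ i → i < k → bit t i ≡ 1) → 2 ^ k ≤ suc t
trailed-bound zero    t low = s≤s z≤n
trailed-bound (suc k) t low with parity t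
... | even t%2 _ _     = ⊥-elim (0≢1+n (trans (sym t%2) (low 0 z<s)))
... | odd _ _ _ sn = subst (2 * 2 ^ k ≤_) (sym sn)
        (*-monoʳ-≤ 2 (trailed-bound k (t / 2) (λ i i<k → low (suc i) (s<s i<k))))

trail<size : ∀ k K t → (∀ i → i < k → bit t i ≡ 1) → suc t < 2 ^ K → k < K
trail<size k K t low fits =
  ≰⇒> (λ K≤k → <⇒≱ fits (≤-trans (^-monoʳ-≤ 2 K≤k) (trailed-bound k t low)))

-- A k-trailed number with no bit above k is followed by 2^k, whose only bit is k.
increment-strongly-trailed : ∀ k t → StronglyKTrailed k t → ∀ i → Active (suc t) i → i ≡ k
increment-strongly-trailed k t ((low , bitk) , high) i active
  with increment-trailed k t low bitk | <-cmp i k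
... | cleared , _ , _    | tri< i<k _ _ = ⊥-elim (0≢1+n (trans (sym (cleared i i<k)) active))
... | _                  | tri≈ _ i≡k _ = i≡k
... | _ , _ , kept       | tri> _ _ k<i =
  ⊥-elim (0≢1+n (trans (sym (high i k<i)) (trans (sym (kept i k<i)) active)))

module FilterSingle (P : ℕ → Set) (P? : ∀ i → Dec (P i))
                    (k : ℕ) (only-k : ∀ i → P i → i ≡ k) where

  -- upTo (n + 1) = upTo n ++ [n], so filtering it splits the same way.
  filter-upTo-snoc : ∀ n → filter P? (upTo (suc n)) ≡ filter P? (upTo n) ++ filter P? (n ∷ [])
  filter-upTo-snoc n = trans (cong (filter P?) (sym (upTo-∷ʳ n))) (filter-++ P? (upTo n) (n ∷ []))

  filter-below : ∀ n → n ≤ k → filter P? (upTo n) ≡ []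
  filter-below zero    _     = refl
  filter-below (suc n) sn≤k  = trans (filter-upTo-snoc n)
    (cong₂ _++_ (filter-below n (≤-trans (n≤1+n n) sn≤k))
                (filter-reject P? λ Pn → <-irrefl (only-k n Pn) sn≤k))

  filter-beyond : P k → ∀ n → k < n → filter P? (upTo n) ≡ k ∷ []
  filter-beyond Pk (suc n) (s≤s k≤n) with m≤n⇒m<n∨m≡n k≤n
  ... | inj₁ k<n = trans (filter-upTo-snoc n)
    (cong₂ _++_ (filter-beyond Pk n k<n) (filter-reject P? λ Pn → <-irrefl (sym (only-k n Pn)) k<n))
  ... | inj₂ refl = trans (filter-upTo-snoc k)
    (cong₂ _++_ (filter-below k ≤-refl) (filter-accept P? Pk))

module Insertion {a ℓ₁ ℓ₂ : Level} (O : DecTotalOrder a ℓ₁ ℓ₂) where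
  open BWA O
  open DecTotalOrder O renaming (Carrier to A) using (_≤?_)

  writeFrom-read : ∀ (f : ℕ → A) p xs → applyUpTo (λ i → writeFrom f p xs (p + i)) (length xs) ≡ xs
  writeFrom-read f p []       = refl
  writeFrom-read f p (x ∷ xs) = cong₂ _∷_ written (trans skip (writeFrom-read f (suc p) xs))
    where
      p≡ᵇp : ∀ n → (n ≡ᵇ n) ≡ true
      p≡ᵇp zero    = refl
      p≡ᵇp (suc n) = p≡ᵇp n

      beyond : ∀ n i → (n + suc i ≡ᵇ n) ≡ false
      beyond zero    i = refl
      beyond (suc n) i = beyond n i

      written : writeFrom f p (x ∷ xs) (p + 0) ≡ x
      written rewrite +-identityʳ p | p≡ᵇp p = refl

      rest : ℕ → A
      rest = writeFrom f (suc p) xs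

      shift : ∀ i → writeFrom f p (x ∷ xs) (p + suc i) ≡ rest (suc p + i)
      shift i rewrite beyond p i = cong rest (+-suc p i)

      skip : applyUpTo (λ i → writeFrom f p (x ∷ xs) (p + suc i)) (length xs)
           ≡ applyUpTo (λ i → rest (suc p + i)) (length xs)
      skip = trans (sym (map-upTo _ (length xs)))
               (trans (map-cong shift (upTo (length xs))) (map-upTo _ (length xs)))

  length-seg : ∀ (f : ℕ → A) j → length (seg f j) ≡ 2 ^ j
  length-seg f j = trans (length-map _ (upTo (2 ^ j))) (length-upTo (2 ^ j))

  seg-writeSeg : ∀ (f : ℕ → A) j xs → length xs ≡ 2 ^ j → seg (writeSeg f j xs) j ≡ xs
  seg-writeSeg f j xs |xs| =
    trans (map-upTo _ (2 ^ j)) (trans (cong (applyUpTo _) (sym |xs|)) (writeFrom-read f (2 ^ j) xs))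

  mergeSeg : (ℕ → A) → (ℕ → A) → ℕ → List A
  mergeSeg b w i = merge _≤?_ (seg b i) (seg w i)

  length-mergeSeg : ∀ b w i → length (mergeSeg b w i) ≡ 2 ^ suc i
  length-mergeSeg b w i = begin
    length (mergeSeg b w i)                ≡⟨ ↭-length (merge-↭ _≤?_ (seg b i) (seg w i)) ⟩
    length (seg b i ++ seg w i)            ≡⟨ length-++ (seg b i) ⟩
    length (seg b i) + length (seg w i)    ≡⟨ cong₂ _+_ (length-seg b i) (length-seg w i) ⟩
    2 ^ i + 2 ^ i                          ≡⟨ cong (2 ^ i +_) (sym (+-identityʳ (2 ^ i))) ⟩
    2 ^ suc i                              ∎
    where open ≡-Reasoning

  lowerSegs : (ℕ → A) → ℕ → List A
  lowerSegs w k = concat (map (seg w) (upTo k))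

  lowerSegs-suc : ∀ w i → lowerSegs w (suc i) ≡ lowerSegs w i ++ seg w i
  lowerSegs-suc w i = begin
    concat (map (seg w) (upTo (suc i)))               ≡⟨ cong (λ l → concat (map (seg w) l)) (sym (upTo-∷ʳ i)) ⟩
    concat (map (seg w) (upTo i ++ i ∷ []))           ≡⟨ cong concat (map-++ (seg w) (upTo i) (i ∷ [])) ⟩
    concat (map (seg w) (upTo i) ++ seg w i ∷ [])     ≡⟨ sym (concat-++ (map (seg w) (upTo i)) (seg w i ∷ [])) ⟩
    lowerSegs w i ++ seg w i ++ []                    ≡⟨ cong (lowerSegs w i ++_) (++-identityʳ (seg w i)) ⟩
    lowerSegs w i ++ seg w i                          ∎
    where open ≡-Reasoning

  mergeSeg-collects : ∀ b w v i → seg b i ↭ v ∷ lowerSegs w i →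
    mergeSeg b w i ↭ v ∷ lowerSegs w (suc i)
  mergeSeg-collects b w v i collected =
    ↭-trans (merge-↭ _≤?_ (seg b i) (seg w i))
      (↭-trans (++⁺ʳ (seg w i) collected) (↭-reflexive (cong (v ∷_) (sym (lowerSegs-suc w i)))))

  mergeRec-carry : ∀ fuel t i w b → bit t (suc i) ≡ 1 →
    mergeRec (suc fuel) t i w b ≡ mergeRec fuel t (suc i) w (writeSeg b (suc i) (mergeSeg b w i))
  mergeRec-carry fuel t i w b active rewrite active = refl

  mergeRec-stop : ∀ fuel t i w b → bit t (suc i) ≡ 0 →
    mergeRec (suc fuel) t i w b ≡ (writeSeg w (suc i) (mergeSeg b w i) , b)
  mergeRec-stop fuel t i w b inactive rewrite inactive = refl

  cascade : ∀ t k w v → (∀ i → i < k → bit t i ≡ 1) → bit t k ≡ 0 →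
    ∀ fuel i b → i < k → k ≤ fuel + i → seg b i ↭ v ∷ lowerSegs w i →
    seg (proj₁ (mergeRec fuel t i w b)) k ↭ v ∷ lowerSegs w k
  cascade t k w v low bitk zero i b i<k k≤i _ = ⊥-elim (<-irrefl refl (<-≤-trans i<k k≤i))
  cascade t k w v low bitk (suc fuel) i b i<k k≤fuel+i collected with m≤n⇒m<n∨m≡n i<k
  ... | inj₁ i+1<k rewrite mergeRec-carry fuel t i w b (low (suc i) i+1<k) =
    cascade t k w v low bitk fuel (suc i) _ i+1<k (subst (k ≤_) (sym (+-suc fuel i)) k≤fuel+i)
      (subst (_↭ v ∷ lowerSegs w (suc i)) (sym (seg-writeSeg b (suc i) _ (length-mergeSeg b w i)))
        (mergeSeg-collects b w v i collected))
  ... | inj₂ refl rewrite mergeRec-stop fuel t i w b bitk =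
    subst (_↭ v ∷ lowerSegs w k) (sym (seg-writeSeg w k _ (length-mergeSeg b w i)))
      (mergeSeg-collects b w v i collected)

  total-insert : ∀ K v s → total (insert K v s) ≡ suc (total s)
  total-insert K v (mkState w b t) with active? t 0
  ... | true  = refl
  ... | false = refl

  insert-collects : ∀ K k v w b t → suc t < 2 ^ K → KTrailed k t →
    seg (W (insert K v (mkState w b t))) k ↭ v ∷ lowerSegs w k
  insert-collects K zero v w b t _ (_ , bit0) rewrite bit0 = ↭-refl
  insert-collects K (suc k) v w b t fits (low , bitk) rewrite low 0 z<s =
    cascade t (suc k) w v low bitk K 0 (update b 1 v) z<s
      (subst (suc k ≤_) (sym (+-identityʳ K)) (<⇒≤ (trail<size (suc k) K t low fits))) ↭-refl

  contents-single : ∀ K k s {n} → total s ≡ n → k < K → (∀ i → Active n i → i ≡ k) → Active n k →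
    contents K s ≡ seg (W s) k
  contents-single K k s refl k<K only-k active-k =
    trans (cong (λ ranks → concat (map (seg (W s)) ranks)) (filter-beyond active-k K k<K))
          (++-identityʳ (seg (W s) k))
    where open FilterSingle (Active (total s)) (λ i → bit (total s) i ≟ 1) k only-k

open Insertion

-- Parts (a), (b), (c) for a k-trailed counter t of an array of size 2^K.  The
-- permutation claims concern multisets only.
mainTheorem2 : ∀ {a ℓ₁ ℓ₂ : Level} (O : DecTotalOrder a ℓ₁ ℓ₂) (K k : ℕ)
               (s : BWA.State O) (v : DecTotalOrder.Carrier O) →
               BWA.Stable O s →
               suc (BWA.total s) < 2 ^ K →
               KTrailed k (BWA.total s) →
               let s′ = BWA.insert O K v s in
               (BWA.seg O (BWA.W s′) k ↭ v ∷ concat (map (BWA.seg O (BWA.W s)) (upTo k)))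
               × (∀ i → i < k → ¬ Active (BWA.total s′) i)
               × (StronglyKTrailed k (BWA.total s) →
                  (∀ i → Active (BWA.total s′) i → i ≡ k)
                  × (BWA.contents O K s′ ↭ BWA.seg O (BWA.W s′) k))
mainTheorem2 O K k s@(BWA.mkState w b t) v _ fits trailed@(low , bitk) =
  insert-collects O K k v w b t fits trailed
  , (λ i i<k active → 0≢1+n (trans (sym (cleared i i<k)) (now-active i active)))
  , λ strongly → let only-k = increment-strongly-trailed k t strongly in
      (λ i active → only-k i (now-active i active))
      , ↭-reflexive (contents-single O K k (BWA.insert O K v s) (total-insert O K v s)
                       (trail<size k K t low fits) only-k set-k)
  where
    cleared : ∀ i → i < k → bit (suc t) i ≡ 0
    cleared = proj₁ (increment-trailed k t low bitk)
    set-k : bit (suc t) k ≡ 1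
    set-k = proj₁ (proj₂ (increment-trailed k t low bitk))

    now-active : ∀ i → Active (BWA.total (BWA.insert O K v s)) i → Active (suc t) i
    now-active i = subst (λ n → Active n i) (total-insert O K v s)
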